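{- Let $G$ be an undirected graph in the rotate model and consider the following depth-first search from a source $s$ using colors \textsf{white}, \textsf{gray}, \textsf{black}. Initially all vertices are \textsf{white}; $s$ is colored \textsf{gray} and becomes the current vertex. Whenever the current vertex is a \textsf{gray} vertex $u$, the algorithm scans $u$'s circular adjacency list starting from its front for the first \textsf{white} neighbor; if such a neighbor $v$ exists, it rotates $u$'s list until $v$ is at the front, colors $v$ \textsf{gray}, and $v$ becomes the current vertex (with $u$ as its parent in the DFS tree); otherwise it colors $u$ \textsf{black} and backtracks to $u$'s parent. Suppose $w$ is a vertex with parent $p$ in the DFS tree that has just become \textsf{black}. Then $p$ is the unique vertex in $w$'s adjacency list which (a) is \textsf{gray} and (b) whose current adjacency list has $w$ in the first (front) position.
   Context: Rotate model: the graph is given by an array $V$ where $V[i]$ points into the adjacency list of vertex $i$, adjacency lists being read-only circular singly linked lists; the only allowed modification is a unit-cost rotation moving $V[i]$ to the next node of the circular list. The node currently pointed to by $V[i]$ is the front (first position) of $i$'s current adjacency list. -}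

module Defs where

open import Data.Nat using (ℕ; zero; suc)
open import Data.Fin using (Fin; _≟_)
open import Data.List using (List; []; _∷_; _++_)
open import Data.Maybe using (Maybe; just; nothing)
open import Data.Product using (_×_; _,_)
open import Data.Bool using (Bool; true; false; if_then_else_)
open import Relation.Nullary using (does)
open import Relation.Binary.PropositionalEquality using (_≡_)

data Color : Set where
  white gray black : Color

isWhite : Color → Bool
isWhite white = true
isWhite gray  = false
isWhite black = false

upd : ∀ {n} {A : Set} → (Fin n → A) → Fin n → A → Fin n → A
upd f i x j = if does (j ≟ i) then x else f j

-- Rotate model: a circular adjacency list read from the position V[i]
-- is represented by the list of its nodes starting at the front.
-- One unit-cost rotation moves the pointer to the next node.
rotate : ∀ {A : Set} → List A → List A
rotate []       = []
rotate (x ∷ xs) = xs ++ (x ∷ [])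

rotateN : ∀ {A : Set} → ℕ → List A → List A
rotateN zero    xs = xs
rotateN (suc k) xs = rotateN k (rotate xs)

front : ∀ {A : Set} → List A → Maybe A
front []      = nothing
front (x ∷ _) = just x

firstWhite : ∀ {n} → (Fin n → Color) → List (Fin n) → Maybe (ℕ × Fin n)
firstWhite col [] = nothing
firstWhite col (x ∷ xs) with isWhite (col x)
... | true  = just (0 , x)
... | false with firstWhite col xs
...   | nothing      = nothing
...   | just (k , v) = just (suc k , v)

open import Data.List.Membership.Propositional using (_∈_)

Symmetric : ∀ {n} → (Fin n → List (Fin n)) → Set
Symmetric {n} adj = ∀ (u v : Fin n) → v ∈ adj u → u ∈ adj v

record State (n : ℕ) : Set where
  constructor st
  field
    col     : Fin n → Color
    cur     : Fin n → List (Fin n)        -- current adjacency lists (after rotations)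
    current : Maybe (Fin n)               -- current vertex (nothing = finished)
    par     : Fin n → Maybe (Fin n)
open State public

initial : ∀ {n} → (Fin n → List (Fin n)) → Fin n → State n
initial adj s = st (upd (λ _ → white) s gray) adj (just s) (λ _ → nothing)

data Step {n : ℕ} : State n → State n → Set where
  discover : ∀ (σ : State n) (u v : Fin n) (k : ℕ) →
    current σ ≡ just u → col σ u ≡ gray →
    firstWhite (col σ) (cur σ u) ≡ just (k , v) →
    Step σ (st (upd (col σ) v gray)
               (upd (cur σ) u (rotateN k (cur σ u)))
               (just v)
               (upd (par σ) v (just u)))
  finish : ∀ (σ : State n) (u : Fin n) →
    current σ ≡ just u → col σ u ≡ gray →
    firstWhite (col σ) (cur σ u) ≡ nothing →
    Step σ (st (upd (col σ) u black) (cur σ) (par σ u) (par σ))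

data Reachable {n : ℕ} (adj : Fin n → List (Fin n)) (s : Fin n) : State n → Set where
  start : Reachable adj s (initial adj s)
  next  : ∀ {σ σ′} → Reachable adj s σ → Step σ σ′ → Reachable adj s σ′

module Submission where

-- Between steps the DFS maintains a stack of vertices,
-- the current vertex on top, subject to the invariant `StackInv`:
--   * the gray vertices are exactly the vertices on the stack, which
--     are pairwise distinct;
--   * the stack is a parent chain: each entry has the entry below it
--     as DFS parent (the bottom has none), and the front of every
--     non-top entry's current adjacency list is the entry above it;
--   * every current adjacency list is a rotation of the original one.
-- Discovering v pushes v (the rotation puts v at the front of its
-- parent's list), finishing u pops u; both preserve the invariant, so
-- it holds in every reachable state.  When w finishes it is on top of
-- the stack w ∷ p ∷ rest.  Then p is gray and its front is w; any other
-- gray x is some lower stack entry, whose front is an entry of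
-- p ∷ rest, hence not w by distinctness.

open import Defs
open import Data.Nat using (ℕ; zero; suc)
open import Data.Fin using (Fin; _≟_)
open import Data.List using (List; []; _∷_; _++_)
open import Data.List.Properties using (++-assoc; ++-identityʳ)
open import Data.List.Membership.Propositional using (_∈_)
open import Data.List.Membership.Propositional.Properties using (∈-++⁻)
open import Data.List.Relation.Unary.Any using (here; there)
open import Data.List.Relation.Unary.All as All using (All)
open import Data.List.Relation.Unary.AllPairs using ([]; _∷_)
open import Data.List.Relation.Unary.Unique.Propositional using (Unique)
open import Data.Maybe using (Maybe; just; nothing)
open import Data.Product using (_×_; _,_; Σ; ∃)
open import Data.Sum using (_⊎_; inj₁; inj₂)
open import Data.Bool using (true; false)
open import Relation.Nullary using (¬_; yes; no; contradiction)
open import Relation.Binary.PropositionalEquality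
  using (_≡_; refl; sym; trans; cong; subst)

upd-same : ∀ {n} {A : Set} (f : Fin n → A) i x → upd f i x i ≡ x
upd-same f i x with i ≟ i
... | yes _ = refl
... | no i≢i = contradiction refl i≢i

upd-other : ∀ {n} {A : Set} (f : Fin n → A) i x {j} → ¬ j ≡ i → upd f i x j ≡ f j
upd-other f i x {j} j≢i with j ≟ i
... | yes j≡i = contradiction j≡i j≢i
... | no _ = refl

newly-set : ∀ {n} {A : Set} (f : Fin n → A) i x j {y} →
  upd f i x j ≡ y → ¬ f j ≡ y → j ≡ i × x ≡ y
newly-set f i x j upd≡y fj≢y with j ≟ i
... | yes j≡i = j≡i , upd≡y
... | no _ = contradiction upd≡y fj≢y

rotate-⊆ : ∀ {A : Set} {y : A} (l : List A) → y ∈ rotate l → y ∈ l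
rotate-⊆ [] y∈ = y∈
rotate-⊆ (x ∷ xs) y∈ with ∈-++⁻ xs y∈
... | inj₁ y∈xs = there y∈xs
... | inj₂ (here y≡x) = here y≡x

rotateN-⊆ : ∀ {A : Set} {y : A} k (l : List A) → y ∈ rotateN k l → y ∈ l
rotateN-⊆ zero l y∈ = y∈
rotateN-⊆ (suc k) l y∈ = rotate-⊆ l (rotateN-⊆ k (rotate l) y∈)

front-∈ : ∀ {A : Set} (l : List A) {x} → front l ≡ just x → x ∈ l
front-∈ (y ∷ l) refl = here refl

firstWhite-cons : ∀ {n} (col : Fin n → Color) x xs {k v} →
  firstWhite col (x ∷ xs) ≡ just (k , v) →
  (isWhite (col x) ≡ true × k ≡ 0 × v ≡ x)
  ⊎ ∃ λ k′ → k ≡ suc k′ × firstWhite col xs ≡ just (k′ , v)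
firstWhite-cons col x xs found with isWhite (col x)
... | true with found
...   | refl = inj₁ (refl , refl , refl)
firstWhite-cons col x xs found | false with firstWhite col xs
...   | just (k′ , v) with found
...     | refl = inj₂ (k′ , refl , refl)

isWhite-sound : ∀ c → isWhite c ≡ true → c ≡ white
isWhite-sound white _ = refl

firstWhite-white : ∀ {n} (col : Fin n → Color) l {k v} →
  firstWhite col l ≡ just (k , v) → col v ≡ white
firstWhite-white col (x ∷ xs) found with firstWhite-cons col x xs found
... | inj₁ (x-white , _ , refl) = isWhite-sound (col x) x-white
... | inj₂ (_ , _ , found′) = firstWhite-white col xs found′

-- ... and rotating by the returned offset brings it to the front, even
-- if further nodes follow the scanned segment (needed for the recursion,
-- since each rotation appends the skipped node at the end).
firstWhite-front-++ : ∀ {n} (col : Fin n → Color) l ys {k v} →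
  firstWhite col l ≡ just (k , v) → front (rotateN k (l ++ ys)) ≡ just v
firstWhite-front-++ col (x ∷ xs) ys found with firstWhite-cons col x xs found
... | inj₁ (_ , refl , refl) = refl
... | inj₂ (_ , refl , found′)
  rewrite ++-assoc xs ys (x ∷ []) = firstWhite-front-++ col xs (ys ++ x ∷ []) found′

firstWhite-front : ∀ {n} (col : Fin n → Color) l {k v} →
  firstWhite col l ≡ just (k , v) → front (rotateN k l) ≡ just v
firstWhite-front col l {k} {v} found =
  subst (λ l′ → front (rotateN k l′) ≡ just v) (++-identityʳ l)
        (firstWhite-front-++ col l [] found)

data ParentChain {n} (P : Fin n → Maybe (Fin n)) (C : Fin n → List (Fin n))
     : List (Fin n) → Set where
  empty : ParentChain P C []
  root  : ∀ r → P r ≡ nothing → ParentChain P C (r ∷ [])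
  child : ∀ c x l → P c ≡ just x → front (C x) ≡ just c →
          ParentChain P C (x ∷ l) → ParentChain P C (c ∷ x ∷ l)

chain-cong : ∀ {n} {P P′ : Fin n → Maybe (Fin n)} {C C′ : Fin n → List (Fin n)} a l →
  (∀ {x} → x ∈ a ∷ l → P x ≡ P′ x) → (∀ {x} → x ∈ l → C x ≡ C′ x) →
  ParentChain P C (a ∷ l) → ParentChain P′ C′ (a ∷ l)
chain-cong a [] sameP sameC (root .a Pa) = root a (trans (sym (sameP (here refl))) Pa)
chain-cong a (x ∷ l) sameP sameC (child .a .x .l Pa front-x chain) =
  child a x l (trans (sym (sameP (here refl))) Pa)
              (trans (cong front (sym (sameC (here refl)))) front-x)
              (chain-cong x l (λ m → sameP (there m)) (λ m → sameC (there m)) chain)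

chain-tail : ∀ {n} {P : Fin n → Maybe (Fin n)} {C} a l →
  ParentChain P C (a ∷ l) → ParentChain P C l
chain-tail a [] (root .a _) = empty
chain-tail a (x ∷ l) (child .a .x .l _ _ chain) = chain

chain-parent : ∀ {n} {P : Fin n → Maybe (Fin n)} {C} a l →
  ParentChain P C (a ∷ l) → P a ≡ front l
chain-parent a [] (root .a Pa) = Pa
chain-parent a (x ∷ l) (child .a .x .l Pa _ _) = Pa

chain-front : ∀ {n} {P : Fin n → Maybe (Fin n)} {C} a l →
  ParentChain P C (a ∷ l) → ∀ {x} → x ∈ l →
  Σ (Fin n) λ c → c ∈ a ∷ l × front (C x) ≡ just c
chain-front a (x ∷ l) (child .a .x .l _ front-x _) (here refl) = a , here refl , front-x
chain-front a (x ∷ l) (child .a .x .l _ _ chain) (there m)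
  with chain-front x l chain m
... | c , c∈ , front-c = c , there c∈ , front-c

record StackInv {n} (adj : Fin n → List (Fin n)) (σ : State n) (stk : List (Fin n)) : Set where
  field
    current-top  : current σ ≡ front stk
    gray-stacked : ∀ {x} → col σ x ≡ gray → x ∈ stk
    stacked-gray : ∀ {x} → x ∈ stk → col σ x ≡ gray
    chain        : ParentChain (par σ) (cur σ) stk
    distinct     : Unique stk
    cur⊆adj      : ∀ x {y} → y ∈ cur σ x → y ∈ adj x
open StackInv

initial-inv : ∀ {n} (adj : Fin n → List (Fin n)) s → StackInv adj (initial adj s) (s ∷ [])
initial-inv adj s = record
  { current-top  = refl
  ; gray-stacked = only-s-gray
  ; stacked-gray = λ { (here refl) → upd-same (λ _ → white) s gray }
  ; chain        = root s refl
  ; distinct     = All.[] ∷ []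
  ; cur⊆adj      = λ x y∈ → y∈
  }
  where
  only-s-gray : ∀ {x} → upd (λ _ → white) s gray x ≡ gray → x ∈ s ∷ []
  only-s-gray {x} x-gray with newly-set (λ _ → white) s gray x x-gray (λ ())
  ... | refl , _ = here refl

current-on-top : ∀ {n} {adj : Fin n → List (Fin n)} {σ stk u} →
  StackInv adj σ stk → current σ ≡ just u → ∃ λ rest → stk ≡ u ∷ rest
current-on-top {stk = []} I cu with trans (sym (current-top I)) cu
... | ()
current-on-top {stk = a ∷ rest} I cu with trans (sym (current-top I)) cu
... | refl = rest , refl

discover-inv : ∀ {n} {adj : Fin n → List (Fin n)} (σ : State n) u v k rest →
  StackInv adj σ (u ∷ rest) → firstWhite (col σ) (cur σ u) ≡ just (k , v) →
  StackInv adj (st (upd (col σ) v gray) (upd (cur σ) u (rotateN k (cur σ u)))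
                   (just v) (upd (par σ) v (just u)))
               (v ∷ u ∷ rest)
discover-inv {adj = adj} σ u v k rest I found = record
  { current-top  = refl
  ; gray-stacked = gray-stacked′
  ; stacked-gray = stacked-gray′
  ; chain        = child v u rest (upd-same (par σ) v (just u))
                     (trans (cong front (upd-same (cur σ) u _)) (firstWhite-front (col σ) (cur σ u) found))
                     (chain-cong u rest (λ m → sym (upd-other (par σ) v _ (not-v m)))
                                        (λ m → sym (upd-other (cur σ) u _ (not-u m)))
                                        (chain I))
  ; distinct     = All.tabulate (λ m v≡x → not-v m (sym v≡x)) ∷ distinct I
  ; cur⊆adj      = cur⊆adj′
  }
  where
  -- v is white, so it is not yet on the stack.
  not-v : ∀ {x} → x ∈ u ∷ rest → ¬ x ≡ v
  not-v m refl with trans (sym (stacked-gray I m)) (firstWhite-white (col σ) (cur σ u) found)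
  ... | ()
  not-u : ∀ {x} → x ∈ rest → ¬ x ≡ u
  not-u m x≡u with distinct I
  ... | u≢ ∷ _ = All.lookup u≢ m (sym x≡u)
  gray-stacked′ : ∀ {x} → upd (col σ) v gray x ≡ gray → x ∈ v ∷ u ∷ rest
  gray-stacked′ {x} x-gray with x ≟ v
  ... | yes refl = here refl
  ... | no _ = there (gray-stacked I x-gray)
  stacked-gray′ : ∀ {x} → x ∈ v ∷ u ∷ rest → upd (col σ) v gray x ≡ gray
  stacked-gray′ (here refl) = upd-same (col σ) v gray
  stacked-gray′ (there m) = trans (upd-other (col σ) v gray (not-v m)) (stacked-gray I m)
  cur⊆adj′ : ∀ x {y} → y ∈ upd (cur σ) u (rotateN k (cur σ u)) x → y ∈ adj x
  cur⊆adj′ x y∈ with x ≟ u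
  ... | yes refl = cur⊆adj I u (rotateN-⊆ k (cur σ u) y∈)
  ... | no _ = cur⊆adj I x y∈

finish-inv : ∀ {n} {adj : Fin n → List (Fin n)} (σ : State n) u rest →
  StackInv adj σ (u ∷ rest) →
  StackInv adj (st (upd (col σ) u black) (cur σ) (par σ u) (par σ)) rest
finish-inv σ u rest I = record
  { current-top  = chain-parent u rest (chain I)
  ; gray-stacked = gray-stacked′
  ; stacked-gray = λ m → trans (upd-other (col σ) u black (not-u m)) (stacked-gray I (there m))
  ; chain        = chain-tail u rest (chain I)
  ; distinct     = rest-distinct (distinct I)
  ; cur⊆adj      = cur⊆adj I
  }
  where
  rest-distinct : Unique (u ∷ rest) → Unique rest
  rest-distinct (_ ∷ d) = d
  not-u : ∀ {x} → x ∈ rest → ¬ x ≡ u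
  not-u m x≡u with distinct I
  ... | u≢ ∷ _ = All.lookup u≢ m (sym x≡u)
  gray-stacked′ : ∀ {x} → upd (col σ) u black x ≡ gray → x ∈ rest
  gray-stacked′ {x} x-gray with x ≟ u
  ... | yes refl = contradiction x-gray λ ()
  ... | no x≢u with gray-stacked I x-gray
  ...   | here x≡u = contradiction x≡u x≢u
  ...   | there m = m

step-inv : ∀ {n} {adj : Fin n → List (Fin n)} {σ σ′ stk} →
  StackInv adj σ stk → Step σ σ′ → ∃ (StackInv adj σ′)
step-inv I (discover σ u v k cu _ found) with current-on-top I cu
... | rest , refl = _ , discover-inv σ u v k rest I found
step-inv I (finish σ u cu _ _) with current-on-top I cu
... | rest , refl = _ , finish-inv σ u rest I

reachable-inv : ∀ {n} (adj : Fin n → List (Fin n)) s {σ} →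
  Reachable adj s σ → ∃ (StackInv adj σ)
reachable-inv adj s start = _ , initial-inv adj s
reachable-inv adj s (next reach step) with reachable-inv adj s reach
... | _ , I = step-inv I step

current-and-parent : ∀ {n} {adj : Fin n → List (Fin n)} {σ stk w p} →
  StackInv adj σ stk → current σ ≡ just w → par σ w ≡ just p →
  ∃ λ rest → stk ≡ w ∷ p ∷ rest
current-and-parent I cw pw with current-on-top I cw
... | rest , refl with trans (sym (chain-parent _ rest (chain I))) pw
current-and-parent I cw pw | p ∷ rest , refl | refl = rest , refl

parent-unique-pointer : ∀ {n} {adj : Fin n → List (Fin n)} → Symmetric adj →
  ∀ {σ w p rest} → StackInv adj σ (w ∷ p ∷ rest) →
  let col′ = upd (col σ) w black in
  (p ∈ adj w × col′ p ≡ gray × front (cur σ p) ≡ just w)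
  × (∀ x → x ∈ adj w → col′ x ≡ gray → front (cur σ x) ≡ just w → x ≡ p)
parent-unique-pointer {adj = adj} symm {σ} {w} {p} {rest} I with chain I | distinct I
... | child .w .p .rest _ front-p chain′ | w≢ ∷ _ =
  ( symm p w (cur⊆adj I p (front-∈ (cur σ p) front-p))
  , trans (upd-other (col σ) w black (λ p≡w → All.lookup w≢ (here refl) (sym p≡w)))
          (stacked-gray I (there (here refl)))
  , front-p )
  , only-p
  where
  only-p : ∀ x → x ∈ adj w → upd (col σ) w black x ≡ gray → front (cur σ x) ≡ just w → x ≡ p
  only-p x _ x-gray front-x with gray-stacked (finish-inv σ w (p ∷ rest) I) x-gray
  ... | here x≡p = x≡p
  ... | there x∈rest with chain-front p rest chain′ x∈rest
  ...   | c , c∈ , front-c with trans (sym front-c) front-x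
  ...     | refl = contradiction refl (All.lookup w≢ c∈)

lemma1 : ∀ (n : ℕ) (adj : Fin n → List (Fin n)) → Symmetric adj →
    ∀ (s : Fin n) (σ σ′ : State n) (w p : Fin n) →
    Reachable adj s σ → Step σ σ′ →
    ¬ (col σ w ≡ black) → col σ′ w ≡ black →
    par σ′ w ≡ just p →
    (p ∈ adj w × col σ′ p ≡ gray × front (cur σ′ p) ≡ just w)
    × (∀ (x : Fin n) → x ∈ adj w → col σ′ x ≡ gray → front (cur σ′ x) ≡ just w → x ≡ p)
-- Discovery only colors a vertex gray, so it cannot blacken w.
lemma1 n adj symm s σ _ w p reach (discover σ u v k _ _ _) was-not-black now-black _
  with newly-set (col σ) v gray w now-black was-not-black
... | _ , ()
-- Finishing blackens only the current vertex u, so w = u is on top of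
-- the stack, directly above its parent p.
lemma1 n adj symm s σ _ w p reach (finish σ u cu _ _) was-not-black now-black pw
  with newly-set (col σ) u black w now-black was-not-black
... | refl , _ with reachable-inv adj s reach
... | _ , I with current-and-parent I cu pw
... | _ , refl = parent-unique-pointer symm I
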